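{- Let $A$ be an $\varepsilon$NFA and let $w\in\Sigma^*$. Then $\mathcal{L}(A_{\mathrm{sup}})=\mathcal{L}(\mathrm{cond}(A_{\mathrm{sup}}))$.
   Context: An $\varepsilon$NFA is a tuple $A=(Q,\Sigma,q_0,q_f,\delta)$ with $\delta\subseteq Q\times(\Sigma\cup\{\varepsilon\})\times Q$; $\mathcal{L}(A)$ is the set of strings labelling (ignoring $\varepsilon$) a path from $q_0$ to $q_f$. $A_{\mathrm{sup}}$ is obtained from $A$ by adding a transition $(p,\varepsilon,q)$ for every transition $(p,b,q)$ of $A$ with $b\in\Sigma$. For an $\varepsilon$NFA $B$ viewed as a directed graph on its states, $\mathrm{SCC}_B[p]$ is the strongly connected component containing $p$; the condensation $\mathrm{cond}(B)$ has the SCCs of $B$ as states, a transition $(\mathrm{SCC}_B[p],a,\mathrm{SCC}_B[q])$ for every transition $(p,a,q)$ of $B$, initial state $\mathrm{SCC}_B[q_0]$ and final state $\mathrm{SCC}_B[q_f]$. Standing assumption: $A$ is trimmed (every state reachable from $q_0$ and can reach $q_f$). -}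

module Defs where

open import Data.Nat using (ℕ)
open import Data.Fin using (Fin)
open import Data.Maybe using (Maybe; just; nothing)
open import Data.List using (List; []; _∷_)
open import Data.Product using (Σ; ∃; _×_; _,_)
open import Relation.Binary.PropositionalEquality using (_≡_)
open import Relation.Binary.Construct.Closure.ReflexiveTransitive using (Star)

-- An εNFA over alphabet Σ with finitely many states Fin n.
-- Transition labels are Maybe Σ, where nothing = ε.
record εNFA (Σ : Set) : Set₁ where
  field
    n  : ℕ
    q₀ : Fin n
    q_f : Fin n
    δ  : Fin n → Maybe Σ → Fin n → Set

_∷ᵐ_ : {Σ : Set} → Maybe Σ → List Σ → List Σ
nothing ∷ᵐ w = w
just a  ∷ᵐ w = a ∷ w

module _ {Σ : Set} (B : εNFA Σ) where
  open εNFA B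

  -- Runs in the automaton whose states are the classes of an equivalence ~
  -- on Fin n, with a transition ([p],a,[q]) for every transition (p,a,q):
  -- a run is a sequence of classes, each represented by some state;
  -- consecutive classes are linked by a transition whose endpoints lie in them.
  data RunMod (_~_ : Fin n → Fin n → Set) : Fin n → List Σ → Fin n → Set where
    here : ∀ {x y} → x ~ y → RunMod _~_ x [] y
    step : ∀ {x p a q w y} → x ~ p → δ p a q → RunMod _~_ q w y → RunMod _~_ x (a ∷ᵐ w) y

  Run : Fin n → List Σ → Fin n → Set
  Run = RunMod _≡_

  L : List Σ → Set
  L w = Run q₀ w q_f

  Arc : Fin n → Fin n → Set
  Arc x y = ∃ λ a → δ x a y

  Reach : Fin n → Fin n → Set
  Reach = Star Arc

  SameSCC : Fin n → Fin n → Set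
  SameSCC x y = Reach x y × Reach y x

  -- L(cond(B)): the states of cond(B) are the SCCs, transitions
  -- (SCC[p],a,SCC[q]) for (p,a,q) in δ, initial SCC[q₀], final SCC[q_f].
  Lcond : List Σ → Set
  Lcond w = RunMod SameSCC q₀ w q_f

  Trimmed : Set
  Trimmed = ∀ q → Reach q₀ q × Reach q q_f

data SupΔ {Σ : Set} (A : εNFA Σ) : Fin (εNFA.n A) → Maybe Σ → Fin (εNFA.n A) → Set where
  orig : ∀ {p a q} → εNFA.δ A p a q → SupΔ A p a q
  eps  : ∀ {p b q} → εNFA.δ A p (just b) q → SupΔ A p nothing q

sup : {Σ : Set} → εNFA Σ → εNFA Σ
sup A = record { n = εNFA.n A ; q₀ = εNFA.q₀ A ; q_f = εNFA.q_f A ; δ = SupΔ A }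

-- In A_sup every transition can also be taken silently, so following any path
-- of A_sup reads no letters. A run of cond(A_sup) differs from a run of A_sup
-- only by jumps between states of one SCC, and each such jump is realised by
-- an ε-path. Conversely a run of A_sup is a run of its condensation, since
-- equal states lie in the same SCC.
module Submission where

open import Defs
open import Data.List using (List)
open import Data.Fin using (Fin)
open import Data.Maybe using (just; nothing)
open import Data.Product using (_,_; proj₁)
open import Function.Base using (_∘_)
open import Function.Bundles using (_⇔_; mk⇔)
open import Relation.Binary.Core using (Rel; _⇒_)
open import Relation.Binary.PropositionalEquality using (_≡_; refl)
open import Relation.Binary.Construct.Closure.ReflexiveTransitive using (ε; _◅_)

module _ {Σ : Set} (B : εNFA Σ) where
  open εNFA B

  RunMod-mono : {R S : Rel (Fin n) _} → R ⇒ S → ∀ {x w y} → RunMod B R x w y → RunMod B S x w y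
  RunMod-mono R⇒S (here xRy)     = here (R⇒S xRy)
  RunMod-mono R⇒S (step xRp d r) = step (R⇒S xRp) d (RunMod-mono R⇒S r)

  ≡⇒SameSCC : _≡_ ⇒ SameSCC B
  ≡⇒SameSCC refl = ε , ε

  ArcsSilent : Set
  ArcsSilent = ∀ {p q} → Arc B p q → δ p nothing q

  module _ (silent : ArcsSilent) where

    Reach-Run-trans : ∀ {x p w y} → Reach B x p → Run B p w y → Run B x w y
    Reach-Run-trans ε          r = r
    Reach-Run-trans (arc ◅ xs) r = step refl (silent arc) (Reach-Run-trans xs r)

    RunMod-Reach⇒Run : ∀ {x w y} → RunMod B (Reach B) x w y → Run B x w y
    RunMod-Reach⇒Run (here xy)     = Reach-Run-trans xy (here refl)
    RunMod-Reach⇒Run (step xp d r) = Reach-Run-trans xp (step refl d (RunMod-Reach⇒Run r))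

sup-arcsSilent : {Σ : Set} (A : εNFA Σ) → ArcsSilent (sup A)
sup-arcsSilent A (nothing , orig d) = orig d
sup-arcsSilent A (just b  , orig d) = eps d
sup-arcsSilent A (_       , eps d)  = eps d

lemma4p3 : {Σ : Set} (A : εNFA Σ) → Trimmed A → (w : List Σ)
           → L (sup A) w ⇔ Lcond (sup A) w
lemma4p3 A _ w =
  mk⇔ (RunMod-mono (sup A) (≡⇒SameSCC (sup A)))
      (RunMod-Reach⇒Run (sup A) (sup-arcsSilent A) ∘ RunMod-mono (sup A) proj₁)
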